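{- Let $G$ be a graph, $\operatorname{X}$ a color change rule, $\omega$ a non-negative real number, and $k$ a constant. Then $\operatorname{th}^{\omega}_{\operatorname{X}}(G)<|V(G)|-k$ if and only if there exist an $\operatorname{X}$ forcing set $B\subseteq V(G)$ and a set of $\operatorname{X}$ forces $\mathcal{F}$ of $B$ such that $\operatorname{pt}_{\operatorname{X}}(G;B)=\operatorname{pt}_{\operatorname{X}}(G;\mathcal{F})$ and \[\sum_{i=1}^{\operatorname{pt}_{\operatorname{X}}(G;B)}\left(|\mathcal{F}^{(i)}|-\omega\right)>k.\]
   Context: All graphs are simple, finite and undirected. A color change rule $\operatorname{X}$ specifies, for a graph $G$ and a current set of blue vertices (others white), which forces $v\rightarrow w$ ($w$ white) are valid; performing one turns $w$ blue. From an initial blue set $B$, applying valid forces until none is possible gives an $\operatorname{X}$ final coloring; $B$ is an $\operatorname{X}$ forcing set if $V(G)$ is an $\operatorname{X}$ final coloring of $B$. The set of forces in a chronological list of forces so performed is a set of $\operatorname{X}$ forces of $B$. For such $\mathcal{F}$: $\mathcal{F}^{(0)}=B$; for $t>0$, with $\bigcup_{i<t}\mathcal{F}^{(i)}$ blue, $\mathcal{F}^{(t)}$ is the set of white $w$ with some blue $b$ such that $(b\rightarrow w)\in\mathcal{F}$ is valid; $\mathcal{F}^{[t]}=\bigcup_{i\le t}\mathcal{F}^{(i)}$. $\operatorname{pt}_{\operatorname{X}}(G;\mathcal{F})$ is the least $q\ge0$ with $\mathcal{F}^{[q]}=V(G)$ ($\infty$ if none), and $\operatorname{pt}_{\operatorname{X}}(G;B)$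 is the minimum of $\operatorname{pt}_{\operatorname{X}}(G;\mathcal{F})$ over sets of $\operatorname{X}$ forces $\mathcal{F}$ of $B$. The weighted throttling number is $\operatorname{th}^{\omega}_{\operatorname{X}}(G)=\min\{|B|+\omega\operatorname{pt}_{\operatorname{X}}(G;B):B\subseteq V(G)\}$. -}

module Defs where

open import Level using (0ℓ) renaming (suc to lsuc)
open import Data.Nat as ℕ using (ℕ; zero; suc)
open import Data.Fin using (Fin; _≟_)
open import Data.Fin.Subset using (Subset; ⊤; _∪_; ⁅_⁆; ∣_∣)
open import Data.Bool using (Bool; true; false; _∧_; not)
open import Data.Vec using (lookup; tabulate)
open import Data.List using (List; []; _∷_; allFin)
open import Data.Bool.ListAction using (any)
open import Data.Product using (_×_; _,_; ∃; Σ)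
open import Data.Sum using (_⊎_)
open import Relation.Nullary using (¬_; does)
open import Relation.Binary.PropositionalEquality using (_≡_; _≢_)
open import Relation.Binary.Structures using (IsStrictTotalOrder)
open import Algebra.Bundles using (CommutativeRing)

-- Ordered commutative rings (ℝ is an instance).  The real parameters
-- ω and k of the paper live in an arbitrary such ring.

record OrderedCommRing : Set₁ where
  field
    commRing : CommutativeRing 0ℓ 0ℓ
  open CommutativeRing commRing public
  infix 4 _<_
  field
    _<_     : Carrier → Carrier → Set
    isSTO   : IsStrictTotalOrder _≈_ _<_
    +-mono-< : ∀ {x y} z → x < y → (x + z) < (y + z)
    *-pos   : ∀ {x y} → 0# < x → 0# < y → 0# < (x * y)
    0<1     : 0# < 1#

  infix 4 _≤_
  _≤_ : Carrier → Carrier → Set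
  x ≤ y = (x < y) ⊎ (x ≈ y)

  fromℕ : ℕ → Carrier
  fromℕ zero    = 0#
  fromℕ (suc m) = 1# + fromℕ m

  sum1 : ℕ → (ℕ → Carrier) → Carrier
  sum1 zero    f = 0#
  sum1 (suc p) f = sum1 p f + f (suc p)

record Graph (n : ℕ) : Set where
  field
    adj    : Fin n → Fin n → Bool
    sym    : ∀ u v → adj u v ≡ adj v u
    irrefl : ∀ v → adj v v ≡ false

-- A color change rule: for a graph G and a current blue set S, decides
-- whether the force v → w is allowed by the rule.
ColorChangeRule : Set
ColorChangeRule = ∀ {n} → Graph n → Subset n → Fin n → Fin n → Bool

module _ (X : ColorChangeRule) {n : ℕ} (G : Graph n) where

  white : Subset n → Fin n → Bool
  white S w = not (lookup S w)

  validB : Subset n → Fin n → Fin n → Bool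
  validB S v w = X G S v w ∧ white S w

  Valid : Subset n → Fin n → Fin n → Set
  Valid S v w = validB S v w ≡ true

  Final : Subset n → Set
  Final S = ∀ v w → ¬ Valid S v w

  data Chron : Subset n → List (Fin n × Fin n) → Set where
    done : ∀ {S} → Chron S []
    step : ∀ {S v w fs} → Valid S v w → Chron (S ∪ ⁅ w ⁆) fs →
           Chron S ((v , w) ∷ fs)

  run : Subset n → List (Fin n × Fin n) → Subset n
  run S []             = S
  run S ((v , w) ∷ fs) = run (S ∪ ⁅ w ⁆) fs

  IsForcingSet : Subset n → Set
  IsForcingSet B = ∃ λ fs → Chron B fs × Final (run B fs) × run B fs ≡ ⊤

  -- fs is (a chronological list whose set is) a set of X forces of B
  IsForceSet : Subset n → List (Fin n × Fin n) → Set
  IsForceSet B fs = Chron B fs × Final (run B fs)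

  memB : List (Fin n × Fin n) → Fin n → Fin n → Bool
  memB fs b w = any (λ { (x , y) → does (x ≟ b) ∧ does (y ≟ w) }) fs

  mutual
    stage : Subset n → List (Fin n × Fin n) → ℕ → Subset n
    stage B fs zero    = B
    stage B fs (suc t) = stage B fs t ∪ layer B fs (suc t)

    layer : Subset n → List (Fin n × Fin n) → ℕ → Subset n
    layer B fs zero    = B
    layer B fs (suc t) = tabulate λ w →
      white S w ∧ any (λ b → lookup S b ∧ memB fs b w ∧ validB S b w) (allFin n)
      where S = stage B fs t

  PtF : Subset n → List (Fin n × Fin n) → ℕ → Set
  PtF B fs q = stage B fs q ≡ ⊤ × (∀ q' → q' ℕ.< q → stage B fs q' ≢ ⊤)

  PtB : Subset n → ℕ → Set
  PtB B p = (∃ λ fs → IsForceSet B fs × PtF B fs p)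
          × (∀ fs q → IsForceSet B fs → PtF B fs q → p ℕ.≤ q)

  -- th^ω_X(G) = t : minimum of |B| + ω pt_X(G;B) over B with finite pt
  -- (sets with pt = ∞ contribute ∞ and never attain the minimum)
  IsThrottling : (R : OrderedCommRing) → OrderedCommRing.Carrier R →
                 OrderedCommRing.Carrier R → Set
  IsThrottling R ω t =
    (∃ λ B → ∃ λ p → PtB B p × t ≈ (fromℕ ∣ B ∣ + ω * fromℕ p))
    × (∀ B p → PtB B p → t ≤ (fromℕ ∣ B ∣ + ω * fromℕ p))
    where open OrderedCommRing R

-- If a set of forces F of B colours everything by time p, its layers F^(0) = B, F^(1), …,
-- F^(p) partition V(G), so n = |B| + Σ_{i=1}^{p} |F^(i)|; subtracting ω p, the inequality
-- |B| + ω p < n − k becomes Σ_{i=1}^{p} (|F^(i)| − ω) > k.  A minimiser B of the throttling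
-- number comes with an F realising pt_X(G; B), and conversely th ≤ |B| + ω pt_X(G; B) for all B.
module Submission where

open import Defs
open import Level using (0ℓ)
open import Data.Nat as ℕ using (ℕ; zero; suc)
open import Data.Nat.Properties using (+-suc)
open import Data.Fin using (Fin; _≟_)
open import Data.Fin.Subset using (Subset; ⊤; _∪_; ⁅_⁆; ∣_∣; _∈_; _∉_; _⊆_; inside; outside)
open import Data.Fin.Subset.Properties
  using (∣⊤∣≡n; ⊆-antisym; ⊆⊤; x∈⁅x⁆; p⊆p∪q; q⊆p∪q; x∈p∪q⁻)
import Relation.Binary.Reasoning.Setoid
open import Data.Bool using (Bool; T; _∧_)
open import Data.Bool.Properties using (T-∧; T-≡; T-not-≡)
open import Data.Bool.ListAction using (any)
open import Data.Vec using ([]; _∷_; lookup; here; there)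
open import Data.Vec.Properties using (lookup∘tabulate; []=⇒lookup)
open import Data.List using (List; []; _∷_; allFin)
open import Data.List.Membership.Propositional using () renaming (_∈_ to _∈ₗ_)
open import Data.List.Relation.Unary.Any as Any using (here; there)
open import Data.List.Relation.Unary.Any.Properties using (any⁻)
open import Data.Product using (_×_; _,_; ∃; proj₁; proj₂)
open import Data.Sum using (inj₁; inj₂)
open import Function using (_∘_)
open import Function.Bundles using (_⇔_; mk⇔; Equivalence)
open import Function.Properties.Equivalence using (⇔-setoid) renaming (trans to ⇔-trans; sym to ⇔-sym)
open import Relation.Nullary using (does; yes; no; contradiction)
open import Relation.Binary.PropositionalEquality using (_≡_; refl; sym; trans; cong; subst)
open import Relation.Binary.Structures using (IsStrictTotalOrder)

∣p∪q∣≡∣p∣+∣q∣ : ∀ {m} (p q : Subset m) → (∀ {x} → x ∈ p → x ∉ q) →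
                ∣ p ∪ q ∣ ≡ ∣ p ∣ ℕ.+ ∣ q ∣
∣p∪q∣≡∣p∣+∣q∣ []            []            _ = refl
∣p∪q∣≡∣p∣+∣q∣ (inside ∷ p)  (inside ∷ q)  disj = contradiction here (disj here)
∣p∪q∣≡∣p∣+∣q∣ (inside ∷ p)  (outside ∷ q) disj =
  cong suc (∣p∪q∣≡∣p∣+∣q∣ p q (λ x∈p x∈q → disj (there x∈p) (there x∈q)))
∣p∪q∣≡∣p∣+∣q∣ (outside ∷ p) (inside ∷ q)  disj =
  trans (cong suc (∣p∪q∣≡∣p∣+∣q∣ p q (λ x∈p x∈q → disj (there x∈p) (there x∈q))))
        (sym (+-suc ∣ p ∣ ∣ q ∣))
∣p∪q∣≡∣p∣+∣q∣ (outside ∷ p) (outside ∷ q) disj =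
  ∣p∪q∣≡∣p∣+∣q∣ p q (λ x∈p x∈q → disj (there x∈p) (there x∈q))

module OrderedCommRingProperties (R : OrderedCommRing) where

  open OrderedCommRing R renaming (refl to ≈-refl; sym to ≈-sym; trans to ≈-trans)
  open IsStrictTotalOrder isSTO using (<-respˡ-≈; <-respʳ-≈) renaming (trans to <-trans)
  open import Algebra.Properties.AbelianGroup +-abelianGroup
    using (//-rightDividesˡ; //-rightDividesʳ)
  open import Algebra.Properties.CommutativeSemigroup +-commutativeSemigroup
    using (interchange; xy∙z≈zy∙x)
  open import Algebra.Properties.Ring ring using (-‿distribˡ-*)
  module ≈-Reasoning = Relation.Binary.Reasoning.Setoid setoid
  module ⇔-Reasoning = Relation.Binary.Reasoning.Setoid (⇔-setoid 0ℓ)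

  ≤-<-trans : ∀ {x y z} → x ≤ y → y < z → x < z
  ≤-<-trans (inj₁ x<y) y<z = <-trans x<y y<z
  ≤-<-trans (inj₂ x≈y) y<z = <-respˡ-≈ (≈-sym x≈y) y<z

  <-cong : ∀ {x x′ y y′} → x ≈ x′ → y ≈ y′ → (x < y) ⇔ (x′ < y′)
  <-cong x≈x′ y≈y′ =
    mk⇔ (<-respˡ-≈ x≈x′ ∘ <-respʳ-≈ y≈y′) (<-respˡ-≈ (≈-sym x≈x′) ∘ <-respʳ-≈ (≈-sym y≈y′))

  +-mono-<-⇔ : ∀ {x y} z → (x < y) ⇔ (x + z < y + z)
  +-mono-<-⇔ {x} {y} z = mk⇔ (+-mono-< z) cancel
    where
    cancel : x + z < y + z → x < y
    cancel x+z<y+z =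
      Equivalence.to (<-cong (//-rightDividesʳ z x) (//-rightDividesʳ z y)) (+-mono-< (- z) x+z<y+z)

  x<y-z⇔x+z<y : ∀ x y z → (x < y - z) ⇔ (x + z < y)
  x<y-z⇔x+z<y x y z =
    ⇔-trans (+-mono-<-⇔ z) (<-cong ≈-refl (//-rightDividesˡ z y))

  k<s-c⇔a+c<a+s-k : ∀ a s c k → (k < s - c) ⇔ (a + c < (a + s) - k)
  k<s-c⇔a+c<a+s-k a s c k = begin
    k < s - c                ≈⟨ x<y-z⇔x+z<y k s c ⟩
    k + c < s                ≈⟨ +-mono-<-⇔ a ⟩
    (k + c) + a < s + a      ≈⟨ <-cong (xy∙z≈zy∙x k c a) (+-comm s a) ⟩
    (a + c) + k < a + s      ≈⟨ ⇔-sym (x<y-z⇔x+z<y (a + c) (a + s) k) ⟩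
    a + c < (a + s) - k      ∎
    where open ⇔-Reasoning

  fromℕ-+ : ∀ a b → fromℕ (a ℕ.+ b) ≈ fromℕ a + fromℕ b
  fromℕ-+ zero    b = ≈-sym (+-identityˡ (fromℕ b))
  fromℕ-+ (suc a) b = ≈-trans (+-congˡ (fromℕ-+ a b)) (≈-sym (+-assoc 1# (fromℕ a) (fromℕ b)))

  sum1-+ : ∀ p f g → sum1 p (λ i → f i + g i) ≈ sum1 p f + sum1 p g
  sum1-+ zero    f g = ≈-sym (+-identityˡ 0#)
  sum1-+ (suc p) f g = begin
    sum1 p (λ i → f i + g i) + (f (suc p) + g (suc p)) ≈⟨ +-congʳ (sum1-+ p f g) ⟩
    (sum1 p f + sum1 p g) + (f (suc p) + g (suc p))     ≈⟨ interchange _ _ _ _ ⟩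
    (sum1 p f + f (suc p)) + (sum1 p g + g (suc p))     ∎
    where open ≈-Reasoning

  sum1-const : ∀ p c → sum1 p (λ _ → c) ≈ c * fromℕ p
  sum1-const zero    c = ≈-sym (zeroʳ c)
  sum1-const (suc p) c = begin
    sum1 p (λ _ → c) + c  ≈⟨ +-congʳ (sum1-const p c) ⟩
    c * fromℕ p + c       ≈⟨ +-comm _ c ⟩
    c + c * fromℕ p       ≈⟨ +-congʳ (*-identityʳ c) ⟨
    c * 1# + c * fromℕ p  ≈⟨ distribˡ c 1# (fromℕ p) ⟨
    c * (1# + fromℕ p)    ∎
    where open ≈-Reasoning

  sum1-sub-const : ∀ p f c → sum1 p (λ i → f i - c) ≈ sum1 p f - c * fromℕ p
  sum1-sub-const p f c = begin
    sum1 p (λ i → f i - c)         ≈⟨ sum1-+ p f (λ _ → - c) ⟩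
    sum1 p f + sum1 p (λ _ → - c)  ≈⟨ +-congˡ (sum1-const p (- c)) ⟩
    sum1 p f + - c * fromℕ p       ≈⟨ +-congˡ (-‿distribˡ-* c (fromℕ p)) ⟨
    sum1 p f - c * fromℕ p         ∎
    where open ≈-Reasoning

  fromℕ-telescope : (c d : ℕ → ℕ) → (∀ t → c (suc t) ≡ c t ℕ.+ d (suc t)) →
                    ∀ t → fromℕ (c t) ≈ fromℕ (c 0) + sum1 t (fromℕ ∘ d)
  fromℕ-telescope c d c-suc zero    = ≈-sym (+-identityʳ (fromℕ (c 0)))
  fromℕ-telescope c d c-suc (suc t) = begin
    fromℕ (c (suc t))                                      ≡⟨ cong fromℕ (c-suc t) ⟩
    fromℕ (c t ℕ.+ d (suc t))                              ≈⟨ fromℕ-+ (c t) (d (suc t)) ⟩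
    fromℕ (c t) + fromℕ (d (suc t))                        ≈⟨ +-congʳ (fromℕ-telescope c d c-suc t) ⟩
    (fromℕ (c 0) + sum1 t (fromℕ ∘ d)) + fromℕ (d (suc t)) ≈⟨ +-assoc _ _ _ ⟩
    fromℕ (c 0) + sum1 (suc t) (fromℕ ∘ d)                 ∎
    where open ≈-Reasoning

module ForcingProcess (X : ColorChangeRule) {n : ℕ} (G : Graph n) where

  ⊆-run : ∀ S fs → S ⊆ run X G S fs
  ⊆-run S []             = λ x∈S → x∈S
  ⊆-run S ((v , w) ∷ fs) = ⊆-run (S ∪ ⁅ w ⁆) fs ∘ p⊆p∪q ⁅ w ⁆

  forced-∈-run : ∀ S fs {v w} → (v , w) ∈ₗ fs → w ∈ run X G S fs
  forced-∈-run S ((_ , w) ∷ fs) (here refl) = ⊆-run (S ∪ ⁅ w ⁆) fs (q⊆p∪q S ⁅ w ⁆ (x∈⁅x⁆ w))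
  forced-∈-run S ((_ , w) ∷ fs) (there vw∈fs) = forced-∈-run (S ∪ ⁅ w ⁆) fs vw∈fs

  memB-sound : ∀ fs {b w} → T (memB X G fs b w) → (b , w) ∈ₗ fs
  memB-sound fs = Any.map matches ∘ any⁻ _ fs
    where
    matches : ∀ {b w} {vw : Fin n × Fin n} → T (does (proj₁ vw ≟ b) ∧ does (proj₂ vw ≟ w)) → (b , w) ≡ vw
    matches {b} {w} {v , w′} _ with v ≟ b | w′ ≟ w
    matches () | no _    | _
    matches () | yes _   | no _
    ...        | yes refl | yes refl = refl

  ∈-layer⁻ : ∀ B fs t {w} → w ∈ layer X G B fs (suc t) →
             w ∉ stage X G B fs t × ∃ λ b → (b , w) ∈ₗ fs
  ∈-layer⁻ B fs t {w} w∈layer = w∉S , b , memB-sound fs memB-bw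
    where
    S : Subset n
    S = stage X G B fs t
    canForce : Fin n → Fin n → Bool
    canForce v b = lookup S b ∧ memB X G fs b v ∧ validB X G S b v
    isNew : T (white X G S w ∧ any (canForce w) (allFin n))
    isNew = T-≡ .Equivalence.from
      (trans (sym (lookup∘tabulate (λ v → white X G S v ∧ any (canForce v) (allFin n)) w))
             ([]=⇒lookup w∈layer))
    isWhite : T (white X G S w)
    isWhite = proj₁ (T-∧ {white X G S w} .Equivalence.to isNew)
    w∉S : w ∉ S
    w∉S w∈S with () ← trans (sym ([]=⇒lookup w∈S)) (T-not-≡ .Equivalence.to isWhite)
    forcer : ∃ λ b → T (canForce w b)
    forcer = Any.satisfied (any⁻ (canForce w) (allFin n) (proj₂ (T-∧ {white X G S w} .Equivalence.to isNew)))
    b : Fin n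
    b = proj₁ forcer
    memB-bw : T (memB X G fs b w)
    memB-bw = proj₁ (T-∧ {memB X G fs b w} .Equivalence.to
                      (proj₂ (T-∧ {lookup S b} .Equivalence.to (proj₂ forcer))))

  stage⊆run : ∀ B fs t → stage X G B fs t ⊆ run X G B fs
  stage⊆run B fs zero    = ⊆-run B fs
  stage⊆run B fs (suc t) x∈stage with x∈p∪q⁻ (stage X G B fs t) (layer X G B fs (suc t)) x∈stage
  ... | inj₁ x∈old = stage⊆run B fs t x∈old
  ... | inj₂ x∈new = forced-∈-run B fs (proj₂ (proj₂ (∈-layer⁻ B fs t x∈new)))

  ∣stage∣-suc : ∀ B fs t →
                ∣ stage X G B fs (suc t) ∣ ≡ ∣ stage X G B fs t ∣ ℕ.+ ∣ layer X G B fs (suc t) ∣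
  ∣stage∣-suc B fs t =
    ∣p∪q∣≡∣p∣+∣q∣ (stage X G B fs t) (layer X G B fs (suc t)) (λ x∈old x∈new → proj₁ (∈-layer⁻ B fs t x∈new) x∈old)

  complete-stage⇒forcing : ∀ B fs p → IsForceSet X G B fs → stage X G B fs p ≡ ⊤ → IsForcingSet X G B
  complete-stage⇒forcing B fs p (chron , final) stage≡⊤ = fs , chron , final , run≡⊤
    where
    run≡⊤ : run X G B fs ≡ ⊤
    run≡⊤ = ⊆-antisym ⊆⊤ (λ x∈⊤ → stage⊆run B fs p (subst (_ ∈_) (sym stage≡⊤) x∈⊤))

module _ (R : OrderedCommRing) (X : ColorChangeRule) {n : ℕ} (G : Graph n) where

  open OrderedCommRing R renaming (refl to ≈-refl; sym to ≈-sym; trans to ≈-trans)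
  open OrderedCommRingProperties R
  open ForcingProcess X G

  ∣B∣+∑∣layer∣≈n : ∀ B fs p → stage X G B fs p ≡ ⊤ →
                   fromℕ ∣ B ∣ + sum1 p (λ i → fromℕ ∣ layer X G B fs i ∣) ≈ fromℕ n
  ∣B∣+∑∣layer∣≈n B fs p stage≡⊤ = ≈-trans
    (≈-sym (fromℕ-telescope (λ t → ∣ stage X G B fs t ∣) (λ i → ∣ layer X G B fs i ∣) (∣stage∣-suc B fs) p))
    (reflexive (cong fromℕ (trans (cong ∣_∣ stage≡⊤) (∣⊤∣≡n n))))

  surplus⇔weight< : ∀ ω k B fs p → stage X G B fs p ≡ ⊤ →
                    (k < sum1 p (λ i → fromℕ ∣ layer X G B fs i ∣ - ω))
                      ⇔ (fromℕ ∣ B ∣ + ω * fromℕ p < fromℕ n - k)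
  surplus⇔weight< ω k B fs p stage≡⊤ = begin
    k < sum1 p (λ i → f i - ω)                        ≈⟨ <-cong ≈-refl (sum1-sub-const p f ω) ⟩
    k < sum1 p f - ω * fromℕ p                        ≈⟨ k<s-c⇔a+c<a+s-k (fromℕ ∣ B ∣) (sum1 p f) (ω * fromℕ p) k ⟩
    fromℕ ∣ B ∣ + ω * fromℕ p < (fromℕ ∣ B ∣ + sum1 p f) - k
                                                      ≈⟨ <-cong ≈-refl (+-congʳ (∣B∣+∑∣layer∣≈n B fs p stage≡⊤)) ⟩
    fromℕ ∣ B ∣ + ω * fromℕ p < fromℕ n - k           ∎
    where
    open ⇔-Reasoning
    f : ℕ → Carrier
    f i = fromℕ ∣ layer X G B fs i ∣

lemma2p4 : (R : OrderedCommRing) → let open OrderedCommRing R in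
           {n : ℕ} (G : Graph n) (X : ColorChangeRule) (ω k : Carrier) →
           0# ≤ ω → (t : Carrier) → IsThrottling X G R ω t →
           (t < (fromℕ n - k)
             ⇔ ∃ λ (B : Subset n) → ∃ λ (fs : List (Fin n × Fin n)) → ∃ λ (p : ℕ) →
                 IsForcingSet X G B × IsForceSet X G B fs
                 × PtB X G B p × PtF X G B fs p
                 × k < sum1 p (λ i → fromℕ ∣ layer X G B fs i ∣ - ω))
lemma2p4 R {n} G X ω k _ t ((B , p , ptB@((fs , isForceSet , ptF) , _) , t≈) , t-minimal) =
  mk⇔ (λ t<n-k →
         B , fs , p , complete-stage⇒forcing B fs p isForceSet (proj₁ ptF) , isForceSet , ptB , ptF ,
         Equivalence.from (surplus⇔weight< R X G ω k B fs p (proj₁ ptF)) (<-respˡ-≈ t≈ t<n-k))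
      (λ { (B′ , fs′ , p′ , _ , _ , ptB′ , ptF′ , surplus) →
         ≤-<-trans (t-minimal B′ p′ ptB′)
                   (Equivalence.to (surplus⇔weight< R X G ω k B′ fs′ p′ (proj₁ ptF′)) surplus) })
  where
  open OrderedCommRing R using (isSTO)
  open OrderedCommRingProperties R using (≤-<-trans)
  open IsStrictTotalOrder isSTO using (<-respˡ-≈)
  open ForcingProcess X G using (complete-stage⇒forcing)
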